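{- Let $m,r\geq 1$ be integers, and work in the polynomial ring over $\mathbb{Z}$ in the commuting variables $\{x_i^{(j)}: 1\leq j\leq r,\ 1\leq i\leq m\}$ and $\{y_\ell: 2\leq \ell\leq m+1\}$. For a subset $P\subseteq[m]$ put $\Pi_r P=\prod_{j=1}^r\Big(\sum_{i\in P}x_i^{(j)}\Big)$, and for a finite nonempty set $Q$ of positive integers let $\mathrm{Max}(Q)$ denote its largest element. Then \[\sum_{k=1}^m \Pi_r[k]\,y_{k+1}=\sum_{\substack{U\subseteq [m+1]\\ |U|\geq 2}}\left(\sum_{\varnothing\neq V\subseteq U\setminus\{\mathrm{Max}(U)\}}(-1)^{|U|-|V|-1}\,\Pi_r V\right)y_{\mathrm{Max}(U)},\] where $[k]=\{1,2,\dots,k\}$.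
   Context: $[n]$ denotes $\{1,2,\dots,n\}$. -}

module Defs where

open import Level using (Level)
open import Data.Bool using (Bool; true; false; if_then_else_)
open import Data.Nat using (ℕ; zero; suc; _∸_; _≤?_)
open import Data.Fin using (Fin; zero; suc; toℕ; inject₁)
open import Data.Fin.Subset using (Subset; inside; outside; ∣_∣; _⊆_) renaming (_-_ to _∖[_])
open import Data.Fin.Subset.Properties using (_⊆?_)
open import Data.List using (List; []; _∷_; map; foldr; filter; allFin; _++_)
open import Data.Vec using (Vec; []; _∷_; lookup; tabulate)
open import Data.Maybe using (Maybe; just; nothing)
open import Relation.Nullary using (does)
open import Algebra.Bundles using (CommutativeRing)

allSubsets : (n : ℕ) → List (Subset n)
allSubsets zero = [] ∷ []
allSubsets (suc n) = map (outside ∷_) (allSubsets n) ++ map (inside ∷_) (allSubsets n)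

maxElem : ∀ {n} → Subset n → Maybe (Fin n)
maxElem [] = nothing
maxElem (b ∷ p) with maxElem p
... | just i = just (suc i)
... | nothing = if b then just zero else nothing

-- [k] = {1,...,k} as a subset of [m]; Fin index i stands for i+1, so
-- for k : Fin m (standing for k+1) this is {i | toℕ i ≤ toℕ k}.
initSeg : ∀ {m} → Fin m → Subset m
initSeg k = tabulate (λ i → does (toℕ i ≤? toℕ k))

restrict : ∀ {m} → Subset (suc m) → Subset m
restrict V = tabulate (λ i → lookup V (inject₁ i))

module _ {c ℓ : Level} (R : CommutativeRing c ℓ) where
  open CommutativeRing R

  sumL : List Carrier → Carrier
  sumL = foldr _+_ 0#

  prodL : List Carrier → Carrier
  prodL = foldr _*_ 1#

  sgn : ℕ → Carrier
  sgn zero = 1#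
  sgn (suc n) = - (sgn n)

  -- Π_r P = ∏_{j=1}^r ( ∑_{i ∈ P} x_i^(j) ), with x j i = x_{i+1}^{(j+1)}.
  Π : ∀ {r m} → (Fin r → Fin m → Carrier) → Subset m → Carrier
  Π {r} {m} x P =
    prodL (map (λ j → sumL (map (λ i → if lookup P i then x j i else 0#) (allFin m))) (allFin r))

  -- y_ℓ for ℓ ∈ [m+1] given as index t : Fin (m+1) (t stands for t+1);
  -- y : Fin m → Carrier holds y_2,…,y_{m+1}; y_1 does not exist (value 0, never used).
  yAt : ∀ {m} → (Fin m → Carrier) → Fin (suc m) → Carrier
  yAt y zero = 0#
  yAt y (suc i) = y i

  LHS : ∀ {r m} → (Fin r → Fin m → Carrier) → (Fin m → Carrier) → Carrier
  LHS {r} {m} x y = sumL (map (λ k → Π x (initSeg k) * y k) (allFin m))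

  inner : ∀ {r m} → (Fin r → Fin m → Carrier) → Subset (suc m) → Fin (suc m) → Carrier
  inner {r} {m} x U t =
    sumL (map (λ V → sgn (∣ U ∣ ∸ ∣ V ∣ ∸ 1) * Π x (restrict V))
              (filter (λ V → 1 ≤? ∣ V ∣) (filter (λ V → V ⊆? (U ∖[ t ])) (allSubsets (suc m)))))

  term : ∀ {r m} → (Fin r → Fin m → Carrier) → (Fin m → Carrier) → Subset (suc m) → Carrier
  term x y U with maxElem U
  ... | just t = inner x U t * yAt y t
  ... | nothing = 0#

  RHS : ∀ {r m} → (Fin r → Fin m → Carrier) → (Fin m → Carrier) → Carrier
  RHS {r} {m} x y = sumL (map (term x y) (filter (λ U → 2 ≤? ∣ U ∣) (allSubsets (suc m))))

-- The identity holds with Π_r replaced by an arbitrary function g of subsets, and we prove it in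
-- that generality by induction on m, splitting off the smallest element 1. For U ⊆ {2,…,m+1} the
-- terms of U and U ∪ {1} add up to the term of U for g₁(V) = g(V ∪ {1}) plus
-- (-1)^{|U|-1} g({1}) y_{Max U}: subsets V ∌ 1 occur in both with opposite signs, subsets V ∋ 1
-- give g₁, and the new summand comes from V = {1}. Summing over U, the first part is the
-- identity for g₁ and m - 1, and the alternating sum Σ_{∅≠U⊆[n]} (-1)^{|U|-1} z_{Max U}
-- collapses to z_1, leaving the missing summand g([1]) y_2.
module Submission where

open import Defs
open import Data.Nat using (ℕ; _≥_)
open import Data.Fin using (Fin)
open import Algebra.Bundles using (CommutativeRing)

open import Function using (_∘_)
open import Data.Bool using (if_then_else_; true; false)
open import Data.Nat using (zero; suc; _∸_; _≤_; _<_; _≤?_; s≤s; z≤n)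
open import Data.Nat.Properties using (≤-<-trans; <-≤-trans; <⇒≱; ≰⇒>; ≤-pred; ≤-reflexive)
open import Data.Fin using (zero; suc; toℕ; inject₁)
open import Data.Fin.Properties using (toℕ-inject₁)
open import Data.Fin.Subset using (Subset; inside; outside; ⊥; ∣_∣; _∈_; _⊆_; _-_)
open import Data.Fin.Subset.Properties
  using (_⊆?_; ⊥⊆; ∣⊥∣≡0; p⊆q⇒∣p∣≤∣q∣; x∈p⇒∣p-x∣<∣p∣)
open import Data.List as List using ([]; _∷_; _++_; allFin; filter)
open import Data.List.Properties using (map-++; map-∘; map-tabulate)
open import Data.Vec using ([]; _∷_; here; there; tabulate)
open import Data.Vec.Properties using (tabulate-cong; lookup∘tabulate; tabulate-∘; map-const)
open import Data.Maybe using (just; nothing)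
open import Relation.Nullary using (Dec; yes; no; does; ¬_)
open import Relation.Nullary.Negation using (contradiction)
open import Relation.Binary.PropositionalEquality as ≡ using (_≡_)
import Relation.Binary.Reasoning.Setoid as SetoidReasoning
import Algebra.Properties.Semiring.Sum as SemiringSum

maxElem-∈ : ∀ {n} (U : Subset n) {t} → maxElem U ≡ just t → t ∈ U
maxElem-∈ (b ∷ U) eq with maxElem U in eqU
maxElem-∈ (b ∷ U)       ≡.refl | just s  = there (maxElem-∈ U eqU)
maxElem-∈ (inside ∷ U)  ≡.refl | nothing = here

maxElem≡nothing⇒≡⊥ : ∀ {n} (U : Subset n) → maxElem U ≡ nothing → U ≡ ⊥
maxElem≡nothing⇒≡⊥ []      _  = ≡.refl
maxElem≡nothing⇒≡⊥ (b ∷ U) eq with maxElem U in eqU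
maxElem≡nothing⇒≡⊥ (outside ∷ U) ≡.refl | nothing = ≡.cong (outside ∷_) (maxElem≡nothing⇒≡⊥ U eqU)

maxElem≡nothing⇒∣∣≡0 : ∀ {n} (U : Subset n) → maxElem U ≡ nothing → ∣ U ∣ ≡ 0
maxElem≡nothing⇒∣∣≡0 {n} U eq = ≡.trans (≡.cong ∣_∣ (maxElem≡nothing⇒≡⊥ U eq)) (∣⊥∣≡0 n)

x∈q∧p⊆q-x⇒∣p∣<∣q∣ : ∀ {n} {U V : Subset n} {t} → t ∈ U → V ⊆ U - t → ∣ V ∣ < ∣ U ∣
x∈q∧p⊆q-x⇒∣p∣<∣q∣ t∈U V⊆U-t = ≤-<-trans (p⊆q⇒∣p∣≤∣q∣ V⊆U-t) (x∈p⇒∣p-x∣<∣p∣ t∈U)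

initSeg-zero : ∀ {n} → initSeg {suc n} zero ≡ inside ∷ ⊥
initSeg-zero {n} = ≡.cong (inside ∷_)
  (≡.trans (tabulate-∘ (λ _ → outside) (λ i → i)) (map-const (tabulate (λ i → i)) outside))

restrict-initSeg : ∀ {m} (k : Fin m) → restrict (initSeg (inject₁ k)) ≡ initSeg k
restrict-initSeg k = tabulate-cong λ i →
  ≡.trans (lookup∘tabulate (λ j → does (toℕ j ≤? toℕ (inject₁ k))) (inject₁ i))
          (≡.cong₂ (λ a b → does (a ≤? b)) (toℕ-inject₁ i) (toℕ-inject₁ k))

module _ {c ℓ} (R : CommutativeRing c ℓ) where
  open CommutativeRing R hiding (zero; _-_)
  open import Algebra.Properties.Ring ring using (-‿distribˡ-*; -0#≈0#; -‿+-comm)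
  open import Algebra.Properties.Group +-group using () renaming (\\-leftDividesˡ to x+[-x+y]≈y)
  open import Algebra.Properties.CommutativeSemigroup +-commutativeSemigroup using (interchange)
  open SemiringSum semiring using (sum; sum-cong-≗)
  open import Relation.Binary.Reasoning.Setoid setoid

  infixr 5 [_]·_
  [_]·_ : ∀ {p} {P : Set p} → Dec P → Carrier → Carrier
  [ P? ]· x = if does P? then x else 0#

  []·-comm : ∀ {p q} {P : Set p} {Q : Set q} (P? : Dec P) (Q? : Dec Q) x →
             [ P? ]· [ Q? ]· x ≡ [ Q? ]· [ P? ]· x
  []·-comm P? Q? x with does P? | does Q?
  ... | true  | true  = ≡.refl
  ... | true  | false = ≡.refl
  ... | false | true  = ≡.refl
  ... | false | false = ≡.refl

  []·-zero : ∀ {p} {P : Set p} (P? : Dec P) {x} → (P → x ≈ 0#) → [ P? ]· x ≈ 0#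
  []·-zero (yes p) x≈0 = x≈0 p
  []·-zero (no _)  _   = refl

  []·-neg : ∀ {p} {P : Set p} (P? : Dec P) {x y} → x ≈ - y → [ P? ]· x ≈ - ([ P? ]· y)
  []·-neg (yes _) x≈-y = x≈-y
  []·-neg (no _)  _    = sym -0#≈0#

  []·-redundant : ∀ {p} {P : Set p} (P? : Dec P) {x} → (¬ P → x ≈ 0#) → [ P? ]· x ≈ x
  []·-redundant (yes _)  _     = refl
  []·-redundant (no ¬p) ¬P⇒x≈0 = sym (¬P⇒x≈0 ¬p)

  sgn[1+m∸n∸1]≈-sgn[m∸n∸1] : ∀ {m n} → n < m → sgn R (suc m ∸ n ∸ 1) ≈ - sgn R (m ∸ n ∸ 1)
  sgn[1+m∸n∸1]≈-sgn[m∸n∸1] {suc m} {zero}  _         = refl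
  sgn[1+m∸n∸1]≈-sgn[m∸n∸1] {suc m} {suc n} (s≤s n<m) = sgn[1+m∸n∸1]≈-sgn[m∸n∸1] n<m

  sumSubsets : ∀ n → (Subset n → Carrier) → Carrier
  sumSubsets zero    f = f []
  sumSubsets (suc n) f = sumSubsets n (λ U → f (outside ∷ U)) + sumSubsets n (λ U → f (inside ∷ U))

  sumSubsets-cong : ∀ n {f h : Subset n → Carrier} → (∀ U → f U ≈ h U) → sumSubsets n f ≈ sumSubsets n h
  sumSubsets-cong zero    f≈h = f≈h []
  sumSubsets-cong (suc n) f≈h =
    +-cong (sumSubsets-cong n (λ U → f≈h (outside ∷ U))) (sumSubsets-cong n (λ U → f≈h (inside ∷ U)))

  sumSubsets-zero : ∀ n {f : Subset n → Carrier} → (∀ U → f U ≈ 0#) → sumSubsets n f ≈ 0#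
  sumSubsets-zero zero    f≈0 = f≈0 []
  sumSubsets-zero (suc n) f≈0 = trans
    (+-cong (sumSubsets-zero n (λ U → f≈0 (outside ∷ U))) (sumSubsets-zero n (λ U → f≈0 (inside ∷ U))))
    (+-identityˡ 0#)

  sumSubsets-+ : ∀ n (f h : Subset n → Carrier) →
                 sumSubsets n (λ U → f U + h U) ≈ sumSubsets n f + sumSubsets n h
  sumSubsets-+ zero    f h = refl
  sumSubsets-+ (suc n) f h = trans (+-cong (sumSubsets-+ n _ _) (sumSubsets-+ n _ _)) (interchange _ _ _ _)

  sumSubsets-neg : ∀ n (f : Subset n → Carrier) → sumSubsets n (λ U → - f U) ≈ - sumSubsets n f
  sumSubsets-neg zero    f = refl
  sumSubsets-neg (suc n) f = trans (+-cong (sumSubsets-neg n _) (sumSubsets-neg n _)) (-‿+-comm _ _)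

  sumSubsets-split-⊥ : ∀ n (f : Subset n → Carrier) →
                       sumSubsets n f ≈ f ⊥ + sumSubsets n (λ V → [ 1 ≤? ∣ V ∣ ]· f V)
  sumSubsets-split-⊥ zero    f = sym (+-identityʳ _)
  sumSubsets-split-⊥ (suc n) f = trans (+-congʳ (sumSubsets-split-⊥ n (λ V → f (outside ∷ V)))) (+-assoc _ _ _)

  sumL-++ : ∀ xs ys → sumL R (xs ++ ys) ≈ sumL R xs + sumL R ys
  sumL-++ []       ys = sym (+-identityˡ _)
  sumL-++ (x ∷ xs) ys = trans (+-congˡ (sumL-++ xs ys)) (sym (+-assoc _ _ _))

  sumL-allSubsets : ∀ n (f : Subset n → Carrier) → sumL R (List.map f (allSubsets n)) ≈ sumSubsets n f
  sumL-allSubsets zero    f = +-identityʳ _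
  sumL-allSubsets (suc n) f = begin
    sumL R (List.map f (List.map (outside ∷_) Us ++ List.map (inside ∷_) Us))
      ≡⟨ ≡.cong (sumL R) (map-++ f (List.map (outside ∷_) Us) _) ⟩
    sumL R (List.map f (List.map (outside ∷_) Us) ++ List.map f (List.map (inside ∷_) Us))
      ≈⟨ sumL-++ (List.map f (List.map (outside ∷_) Us)) _ ⟩
    sumL R (List.map f (List.map (outside ∷_) Us)) + sumL R (List.map f (List.map (inside ∷_) Us))
      ≡⟨ ≡.cong₂ (λ as bs → sumL R as + sumL R bs) (≡.sym (map-∘ Us)) (≡.sym (map-∘ Us)) ⟩
    sumL R (List.map (λ U → f (outside ∷ U)) Us) + sumL R (List.map (λ U → f (inside ∷ U)) Us)
      ≈⟨ +-cong (sumL-allSubsets n _) (sumL-allSubsets n _) ⟩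
    sumSubsets (suc n) f ∎
    where Us = allSubsets n

  sumL-filter : ∀ {a p} {A : Set a} {Q : A → Set p} (Q? : ∀ v → Dec (Q v)) (h : A → Carrier) xs →
                sumL R (List.map h (filter Q? xs)) ≈ sumL R (List.map (λ v → [ Q? v ]· h v) xs)
  sumL-filter Q? h []       = refl
  sumL-filter Q? h (x ∷ xs) with does (Q? x)
  ... | true  = +-congˡ (sumL-filter Q? h xs)
  ... | false = trans (sumL-filter Q? h xs) (sym (+-identityˡ _))

  sumL-tabulate : ∀ {n} (f : Fin n → Carrier) → sumL R (List.tabulate f) ≡ sum f
  sumL-tabulate {zero}  f = ≡.refl
  sumL-tabulate {suc n} f = ≡.cong (f zero +_) (sumL-tabulate (λ i → f (suc i)))

  sumL-allFin : ∀ n (f : Fin n → Carrier) → sumL R (List.map f (allFin n)) ≡ sum f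
  sumL-allFin n f = ≡.trans (≡.cong (sumL R) (map-tabulate (λ i → i) f)) (sumL-tabulate f)

  innerWith : ∀ {n} → (Subset n → Carrier) → Subset n → Fin n → Carrier
  innerWith {n} g U t =
    sumSubsets n λ V → [ V ⊆? U - t ]· [ 1 ≤? ∣ V ∣ ]· (sgn R (∣ U ∣ ∸ ∣ V ∣ ∸ 1) * g V)

  termWith : ∀ {n} → (Subset n → Carrier) → (Fin n → Carrier) → Subset n → Carrier
  termWith g Y U with maxElem U
  ... | just t  = innerWith g U t * Y t
  ... | nothing = 0#

  innerWith-vanishes : ∀ {n} (g : Subset n → Carrier) {U t} → t ∈ U → ∣ U ∣ ≤ 1 → innerWith g U t ≈ 0#
  innerWith-vanishes {n} g {U} {t} t∈U ∣U∣≤1 = sumSubsets-zero n summand≈0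
    where
    summand≈0 : ∀ V → [ V ⊆? U - t ]· [ 1 ≤? ∣ V ∣ ]· (sgn R (∣ U ∣ ∸ ∣ V ∣ ∸ 1) * g V) ≈ 0#
    summand≈0 V = []·-zero (V ⊆? U - t) λ V⊆U-t → []·-zero (1 ≤? ∣ V ∣) λ 1≤∣V∣ →
      contradiction 1≤∣V∣ (<⇒≱ (<-≤-trans (x∈q∧p⊆q-x⇒∣p∣<∣q∣ t∈U V⊆U-t) ∣U∣≤1))

  termWith-vanishes : ∀ {n} (g : Subset n → Carrier) Y U → ∣ U ∣ ≤ 1 → termWith g Y U ≈ 0#
  termWith-vanishes g Y U ∣U∣≤1 with maxElem U in eq
  ... | just t  = trans (*-congʳ (innerWith-vanishes g (maxElem-∈ U eq) ∣U∣≤1)) (zeroˡ _)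
  ... | nothing = refl

  signedAtMax : ∀ {n} → (Fin n → Carrier) → Subset n → Carrier
  signedAtMax Z U with maxElem U
  ... | just t  = sgn R (∣ U ∣ ∸ 1) * Z t
  ... | nothing = 0#

  atEmpty : ∀ {n} → Carrier → Subset n → Carrier
  atEmpty z U with maxElem U
  ... | just _  = 0#
  ... | nothing = z

  sumSubsets-atEmpty : ∀ n z → sumSubsets n (atEmpty z) ≈ z
  sumSubsets-atEmpty zero    z = refl
  sumSubsets-atEmpty (suc n) z =
    trans (+-cong (trans (sumSubsets-cong n outside≈) (sumSubsets-atEmpty n z)) (sumSubsets-zero n inside≈0))
          (+-identityʳ z)
    where
    outside≈ : ∀ U → atEmpty z (outside ∷ U) ≈ atEmpty z U
    outside≈ U with maxElem U
    ... | just _  = refl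
    ... | nothing = refl
    inside≈0 : ∀ U → atEmpty z (inside ∷ U) ≈ 0#
    inside≈0 U with maxElem U
    ... | just _  = refl
    ... | nothing = refl

  -- The terms of U and U ∪ {1} cancel unless U = ∅.
  sumSubsets-signedAtMax : ∀ n (Z : Fin (suc n) → Carrier) → sumSubsets (suc n) (signedAtMax Z) ≈ Z zero
  sumSubsets-signedAtMax n Z = begin
    sumSubsets n (λ U → signedAtMax Z (outside ∷ U)) + sumSubsets n (λ U → signedAtMax Z (inside ∷ U))
      ≈⟨ +-cong (sumSubsets-cong n outside≈) (sumSubsets-cong n inside≈) ⟩
    sumSubsets n (signedAtMax Z′) + sumSubsets n (λ U → - signedAtMax Z′ U + atEmpty (Z zero) U)
      ≈⟨ +-congˡ (trans (sumSubsets-+ n _ _) (+-congʳ (sumSubsets-neg n _))) ⟩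
    sumSubsets n (signedAtMax Z′) + (- sumSubsets n (signedAtMax Z′) + sumSubsets n (atEmpty (Z zero)))
      ≈⟨ x+[-x+y]≈y _ _ ⟩
    sumSubsets n (atEmpty (Z zero))
      ≈⟨ sumSubsets-atEmpty n (Z zero) ⟩
    Z zero ∎
    where
    Z′ : Fin n → Carrier
    Z′ i = Z (suc i)
    outside≈ : ∀ U → signedAtMax Z (outside ∷ U) ≈ signedAtMax Z′ U
    outside≈ U with maxElem U
    ... | just _  = refl
    ... | nothing = refl
    inside≈ : ∀ U → signedAtMax Z (inside ∷ U) ≈ - signedAtMax Z′ U + atEmpty (Z zero) U
    inside≈ U with maxElem U in eq
    ... | just t  = trans (*-congʳ (sgn[1+m∸n∸1]≈-sgn[m∸n∸1] (≤-<-trans z≤n (x∈p⇒∣p-x∣<∣p∣ (maxElem-∈ U eq)))))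
                          (trans (sym (-‿distribˡ-* _ _)) (sym (+-identityʳ _)))
    ... | nothing rewrite maxElem≡nothing⇒∣∣≡0 U eq =
      trans (*-identityˡ _) (sym (trans (+-congʳ -0#≈0#) (+-identityˡ _)))

  module _ {n} (g : Subset (suc n) → Carrier) where
    private
      g₀ g₁ : Subset n → Carrier
      g₀ V = g (outside ∷ V)
      g₁ V = g (inside ∷ V)

    innerWith-outside : ∀ U t → innerWith g (outside ∷ U) (suc t) ≈ innerWith g₀ U t
    innerWith-outside U t = trans (+-congˡ (sumSubsets-zero n (λ _ → refl))) (+-identityʳ _)

    innerWith-inside : ∀ {U t} → t ∈ U →
      innerWith g (inside ∷ U) (suc t) ≈ - innerWith g₀ U t + (sgn R (∣ U ∣ ∸ 1) * g₁ ⊥ + innerWith g₁ U t)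
    innerWith-inside {U} {t} t∈U = +-cong
      (trans (sumSubsets-cong n signFlip) (sumSubsets-neg n _))
      (trans (sumSubsets-split-⊥ n _) (+-cong at⊥ (sumSubsets-cong n λ V →
        reflexive ([]·-comm (1 ≤? ∣ V ∣) (V ⊆? U - t) (sgn R (∣ U ∣ ∸ ∣ V ∣ ∸ 1) * g₁ V)))))
      where
      signFlip : ∀ V → [ V ⊆? U - t ]· [ 1 ≤? ∣ V ∣ ]· (sgn R (suc ∣ U ∣ ∸ ∣ V ∣ ∸ 1) * g₀ V)
                     ≈ - ([ V ⊆? U - t ]· [ 1 ≤? ∣ V ∣ ]· (sgn R (∣ U ∣ ∸ ∣ V ∣ ∸ 1) * g₀ V))
      signFlip V with V ⊆? U - t
      ... | no _      = sym -0#≈0#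
      ... | yes V⊆U-t = []·-neg (1 ≤? ∣ V ∣)
        (trans (*-congʳ (sgn[1+m∸n∸1]≈-sgn[m∸n∸1] (x∈q∧p⊆q-x⇒∣p∣<∣q∣ t∈U V⊆U-t))) (sym (-‿distribˡ-* _ _)))
      at⊥ : [ ⊥ ⊆? U - t ]· (sgn R (∣ U ∣ ∸ ∣ ⊥ {n} ∣ ∸ 1) * g₁ ⊥) ≈ sgn R (∣ U ∣ ∸ 1) * g₁ ⊥
      at⊥ with ⊥ ⊆? U - t
      ... | yes _  = reflexive (≡.cong (λ k → sgn R (∣ U ∣ ∸ k ∸ 1) * g₁ ⊥) (∣⊥∣≡0 n))
      ... | no ⊥⊈ = contradiction (λ {_} → ⊥⊆) ⊥⊈

    innerWith-step : ∀ {U t} → t ∈ U →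
      innerWith g (outside ∷ U) (suc t) + innerWith g (inside ∷ U) (suc t)
        ≈ innerWith g₁ U t + sgn R (∣ U ∣ ∸ 1) * g₁ ⊥
    innerWith-step {U} {t} t∈U = begin
      innerWith g (outside ∷ U) (suc t) + innerWith g (inside ∷ U) (suc t)
        ≈⟨ +-cong (innerWith-outside U t) (innerWith-inside t∈U) ⟩
      innerWith g₀ U t + (- innerWith g₀ U t + (sgn R (∣ U ∣ ∸ 1) * g₁ ⊥ + innerWith g₁ U t))
        ≈⟨ x+[-x+y]≈y _ _ ⟩
      sgn R (∣ U ∣ ∸ 1) * g₁ ⊥ + innerWith g₁ U t
        ≈⟨ +-comm _ _ ⟩
      innerWith g₁ U t + sgn R (∣ U ∣ ∸ 1) * g₁ ⊥ ∎

    termWith-step : ∀ (Y : Fin (suc n) → Carrier) U →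
      termWith g Y (outside ∷ U) + termWith g Y (inside ∷ U)
        ≈ termWith g₁ (Y ∘ suc) U + signedAtMax (λ i → g₁ ⊥ * Y (suc i)) U
    termWith-step Y U with maxElem U in eq
    ... | nothing = +-congˡ (trans (*-congʳ (innerWith-vanishes g here ∣inside∷U∣≤1)) (zeroˡ _))
      where
      ∣inside∷U∣≤1 : ∣ inside ∷ U ∣ ≤ 1
      ∣inside∷U∣≤1 = s≤s (≤-reflexive (maxElem≡nothing⇒∣∣≡0 U eq))
    ... | just t  = begin
      innerWith g (outside ∷ U) (suc t) * y + innerWith g (inside ∷ U) (suc t) * y
        ≈⟨ distribʳ y _ _ ⟨
      (innerWith g (outside ∷ U) (suc t) + innerWith g (inside ∷ U) (suc t)) * y
        ≈⟨ *-congʳ (innerWith-step (maxElem-∈ U eq)) ⟩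
      (innerWith g₁ U t + sgn R (∣ U ∣ ∸ 1) * g₁ ⊥) * y
        ≈⟨ distribʳ y _ _ ⟩
      innerWith g₁ U t * y + (sgn R (∣ U ∣ ∸ 1) * g₁ ⊥) * y
        ≈⟨ +-congˡ (*-assoc _ _ _) ⟩
      innerWith g₁ U t * y + sgn R (∣ U ∣ ∸ 1) * (g₁ ⊥ * y) ∎
      where y = Y (suc t)

    sumSubsets-termWith-suc : ∀ (Y : Fin (suc n) → Carrier) →
      sumSubsets (suc n) (termWith g Y)
        ≈ sumSubsets n (termWith g₁ (Y ∘ suc)) + sumSubsets n (signedAtMax (λ i → g₁ ⊥ * Y (suc i)))
    sumSubsets-termWith-suc Y = trans (sym (sumSubsets-+ n _ _))
      (trans (sumSubsets-cong n (termWith-step Y)) (sumSubsets-+ n _ _))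

  sumSubsets-termWith : ∀ n (g : Subset (suc n) → Carrier) (Y : Fin (suc n) → Carrier) →
    sumSubsets (suc n) (termWith g Y) ≈ sum (λ t → g (initSeg (inject₁ t)) * Y (suc t))
  sumSubsets-termWith zero    g Y = trans (sumSubsets-termWith-suc g Y) (+-identityˡ 0#)
  sumSubsets-termWith (suc n) g Y = begin
    sumSubsets (suc (suc n)) (termWith g Y)
      ≈⟨ sumSubsets-termWith-suc g Y ⟩
    sumSubsets (suc n) (termWith g₁ (Y ∘ suc)) + sumSubsets (suc n) (signedAtMax (λ i → g₁ ⊥ * Y (suc i)))
      ≈⟨ +-cong (sumSubsets-termWith n g₁ (Y ∘ suc)) (sumSubsets-signedAtMax n _) ⟩
    sum (λ t → g₁ (initSeg (inject₁ t)) * Y (suc (suc t))) + g₁ ⊥ * Y (suc zero)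
      ≈⟨ +-comm _ _ ⟩
    g (inside ∷ ⊥) * Y (suc zero) + sum (λ t → g₁ (initSeg (inject₁ t)) * Y (suc (suc t)))
      ≡⟨ ≡.cong (λ S → g S * Y (suc zero) + sum (λ t → g₁ (initSeg (inject₁ t)) * Y (suc (suc t))))
                 (≡.sym initSeg-zero) ⟩
    sum (λ t → g (initSeg (inject₁ t)) * Y (suc t)) ∎
    where
    g₁ : Subset (suc n) → Carrier
    g₁ V = g (inside ∷ V)

  module _ {r m} (x : Fin r → Fin m → Carrier) (y : Fin m → Carrier) where
    private
      Πx : Subset (suc m) → Carrier
      Πx V = Π R x (restrict V)

    LHS≡sum : LHS R x y ≡ sum (λ k → Πx (initSeg (inject₁ k)) * yAt R y (suc k))
    LHS≡sum = ≡.trans (sumL-allFin m _)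
      (sum-cong-≗ λ k → ≡.cong (λ S → Π R x S * y k) (≡.sym (restrict-initSeg k)))

    inner≈innerWith : ∀ U t → inner R x U t ≈ innerWith Πx U t
    inner≈innerWith U t = begin
      inner R x U t
        ≈⟨ sumL-filter (λ V → 1 ≤? ∣ V ∣) _ (filter (λ V → V ⊆? U - t) (allSubsets (suc m))) ⟩
      sumL R (List.map _ (filter (λ V → V ⊆? U - t) (allSubsets (suc m))))
        ≈⟨ sumL-filter (λ V → V ⊆? U - t) _ (allSubsets (suc m)) ⟩
      sumL R (List.map _ (allSubsets (suc m)))
        ≈⟨ sumL-allSubsets (suc m) _ ⟩
      innerWith Πx U t ∎

    term≈termWith : ∀ U → term R x y U ≈ termWith Πx (yAt R y) U
    term≈termWith U with maxElem U
    ... | just t  = *-congʳ (inner≈innerWith U t)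
    ... | nothing = refl

    RHS≈sumSubsets : RHS R x y ≈ sumSubsets (suc m) (termWith Πx (yAt R y))
    RHS≈sumSubsets = begin
      RHS R x y
        ≈⟨ sumL-filter (λ U → 2 ≤? ∣ U ∣) (term R x y) (allSubsets (suc m)) ⟩
      sumL R (List.map (λ U → [ 2 ≤? ∣ U ∣ ]· term R x y U) (allSubsets (suc m)))
        ≈⟨ sumL-allSubsets (suc m) _ ⟩
      sumSubsets (suc m) (λ U → [ 2 ≤? ∣ U ∣ ]· term R x y U)
        ≈⟨ sumSubsets-cong (suc m) filtered≈termWith ⟩
      sumSubsets (suc m) (termWith Πx (yAt R y)) ∎
      where
      filtered≈termWith : ∀ U → [ 2 ≤? ∣ U ∣ ]· term R x y U ≈ termWith Πx (yAt R y) U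
      filtered≈termWith U = trans
        ([]·-redundant (2 ≤? ∣ U ∣) λ ∣U∣≱2 →
          trans (term≈termWith U) (termWith-vanishes Πx (yAt R y) U (≤-pred (≰⇒> ∣U∣≱2))))
        (term≈termWith U)

-- The identity also holds for m = 0 and r = 0.
theorem1p2 : ∀ {c ℓ} (R : CommutativeRing c ℓ) (m r : ℕ) → m ≥ 1 → r ≥ 1 →
    (x : Fin r → Fin m → CommutativeRing.Carrier R) →
    (y : Fin m → CommutativeRing.Carrier R) →
    CommutativeRing._≈_ R (LHS R x y) (RHS R x y)
theorem1p2 R m r _ _ x y = begin
  LHS R x y                                               ≡⟨ LHS≡sum R x y ⟩
  sum (λ k → Πx (initSeg (inject₁ k)) * yAt R y (suc k))  ≈⟨ sumSubsets-termWith R m Πx (yAt R y) ⟨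
  sumSubsets R (suc m) (termWith R Πx (yAt R y))          ≈⟨ RHS≈sumSubsets R x y ⟨
  RHS R x y                                               ∎
  where
  open CommutativeRing R using (_*_; semiring)
  open SemiringSum semiring using (sum)
  open SetoidReasoning (CommutativeRing.setoid R)
  Πx : Subset (suc m) → CommutativeRing.Carrier R
  Πx V = Π R x (restrict V)
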